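{- The logic $\mathcal{F}S$ is sound with respect to the set $\mathsf{R}^s$ of symmetric Epstein relations: for every $\varphi\in\mathcal{F}S$ and every symmetric $\mathfrak{R}\subseteq\mathsf{FOR}^2$, $\mathfrak{R}\vDash\varphi$.
   Context: Let $\Phi=\{p_0,p_1,\dots\}$ be a countably infinite set of propositional letters; $\mathsf{FOR}$ is the set of formulas built from $\Phi$ with $\neg$ and binary $\lor,\wedge,\to,\leftrightarrow,\vartriangle,\looparrowright$. An Epstein model is $\langle v,\mathfrak{R}\rangle$ with $v:\Phi\to\{0,1\}$ and $\mathfrak{R}\subseteq\mathsf{FOR}^2$. Truth: $\langle v,\mathfrak{R}\rangle\vDash p$ iff $v(p)=1$; classical clauses for $\neg,\wedge,\lor,\to,\leftrightarrow$; $\vDash\psi\vartriangle\chi$ iff both $\psi,\chi$ true and $\langle\psi,\chi\rangle\in\mathfrak{R}$; $\vDash\psi\looparrowright\chi$ iff ($\psi$ false or $\chi$ true) and $\langle\psi,\chi\rangle\in\mathfrak{R}$. $\mathfrak{R}\vDash\varphi$ iff $\langle v,\mathfrak{R}\rangle\vDash\varphi$ for every valuation $v$. $\mathcal{F}S$ is the least set of formulas containing all classical tautologies, $(p\looparrowright q)\to(p\to q)$, $(p\vartriangle q)\leftrightarrow((p\looparrowright q)\wedge(p\wedge q))$ and $(s)\ (p\looparrowright q)\to((q\looparrowright p)\lor\neg(q\to p))$ (with $p,q$ distinct letters), closed under uniform substitution and modus ponens. $\mathfrak{R}$ is symmetric iff $\langle\varphi,\psi\rangle\in\mathfrak{R}$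 implies $\langle\psi,\varphi\rangle\in\mathfrak{R}$. -}

module Defs where

open import Data.Nat using (ℕ)
open import Data.Bool using (Bool; true; false; not; _∧_; _∨_; if_then_else_)
open import Relation.Binary.PropositionalEquality using (_≡_)

infixr 6 _∧'_
infixr 5 _∨'_
infixr 4 _⇒_ _⇔_ _△_ _↬_

data FOR : Set where
  var  : ℕ → FOR
  ¬'_  : FOR → FOR
  _∨'_ : FOR → FOR → FOR
  _∧'_ : FOR → FOR → FOR
  _⇒_  : FOR → FOR → FOR
  _⇔_  : FOR → FOR → FOR
  _△_  : FOR → FOR → FOR
  _↬_  : FOR → FOR → FOR

_⇒ᵇ_ : Bool → Bool → Bool
a ⇒ᵇ b = not a ∨ b

_⇔ᵇ_ : Bool → Bool → Bool
a ⇔ᵇ b = (a ⇒ᵇ b) ∧ (b ⇒ᵇ a)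

Valuation : Set
Valuation = ℕ → Bool

Relation : Set
Relation = FOR → FOR → Bool

⟦_⟧ : FOR → Valuation → Relation → Bool
⟦ var n ⟧ v R = v n
⟦ ¬' φ ⟧ v R = not (⟦ φ ⟧ v R)
⟦ φ ∨' ψ ⟧ v R = ⟦ φ ⟧ v R ∨ ⟦ ψ ⟧ v R
⟦ φ ∧' ψ ⟧ v R = ⟦ φ ⟧ v R ∧ ⟦ ψ ⟧ v R
⟦ φ ⇒ ψ ⟧ v R = ⟦ φ ⟧ v R ⇒ᵇ ⟦ ψ ⟧ v R
⟦ φ ⇔ ψ ⟧ v R = ⟦ φ ⟧ v R ⇔ᵇ ⟦ ψ ⟧ v R
⟦ φ △ ψ ⟧ v R = (⟦ φ ⟧ v R ∧ ⟦ ψ ⟧ v R) ∧ R φ ψ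
⟦ φ ↬ ψ ⟧ v R = (⟦ φ ⟧ v R ⇒ᵇ ⟦ ψ ⟧ v R) ∧ R φ ψ

_,_⊨_ : Valuation → Relation → FOR → Set
v , R ⊨ φ = ⟦ φ ⟧ v R ≡ true

_⊨_ : Relation → FOR → Set
R ⊨ φ = ∀ (v : Valuation) → v , R ⊨ φ

Symmetric : Relation → Set
Symmetric R = ∀ φ ψ → R φ ψ ≡ true → R ψ φ ≡ true

data Classical : FOR → Set where
  c-var : ∀ n → Classical (var n)
  c-¬   : ∀ {φ} → Classical φ → Classical (¬' φ)
  c-∨   : ∀ {φ ψ} → Classical φ → Classical ψ → Classical (φ ∨' ψ)
  c-∧   : ∀ {φ ψ} → Classical φ → Classical ψ → Classical (φ ∧' ψ)
  c-⇒   : ∀ {φ ψ} → Classical φ → Classical ψ → Classical (φ ⇒ ψ)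
  c-⇔   : ∀ {φ ψ} → Classical φ → Classical ψ → Classical (φ ⇔ ψ)

evalC : FOR → Valuation → Bool
evalC (var n) v = v n
evalC (¬' φ) v = not (evalC φ v)
evalC (φ ∨' ψ) v = evalC φ v ∨ evalC ψ v
evalC (φ ∧' ψ) v = evalC φ v ∧ evalC ψ v
evalC (φ ⇒ ψ) v = evalC φ v ⇒ᵇ evalC ψ v
evalC (φ ⇔ ψ) v = evalC φ v ⇔ᵇ evalC ψ v
evalC (φ △ ψ) v = false
evalC (φ ↬ ψ) v = false

Tautology : FOR → Set
Tautology φ = Classical φ × (∀ (v : Valuation) → evalC φ v ≡ true)
  where open import Data.Product using (_×_)

Substitution : Set
Substitution = ℕ → FOR

sub : Substitution → FOR → FOR
sub σ (var n) = σ n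
sub σ (¬' φ) = ¬' sub σ φ
sub σ (φ ∨' ψ) = sub σ φ ∨' sub σ ψ
sub σ (φ ∧' ψ) = sub σ φ ∧' sub σ ψ
sub σ (φ ⇒ ψ) = sub σ φ ⇒ sub σ ψ
sub σ (φ ⇔ ψ) = sub σ φ ⇔ sub σ ψ
sub σ (φ △ ψ) = sub σ φ △ sub σ ψ
sub σ (φ ↬ ψ) = sub σ φ ↬ sub σ ψ

p q : FOR
p = var 0
q = var 1

ax1 ax2 axS : FOR
ax1 = (p ↬ q) ⇒ (p ⇒ q)
ax2 = (p △ q) ⇔ ((p ↬ q) ∧' (p ∧' q))
axS = (p ↬ q) ⇒ ((q ↬ p) ∨' ¬' (q ⇒ p))

data FS : FOR → Set where
  taut : ∀ {φ} → Tautology φ → FS φ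
  a1   : FS ax1
  a2   : FS ax2
  aS   : FS axS
  subst-rule : ∀ (σ : Substitution) {φ} → FS φ → FS (sub σ φ)
  mp   : ∀ {φ ψ} → FS φ → FS (φ ⇒ ψ) → FS ψ

-- Tautologies are true because Epstein truth agrees with classical
-- truth on ↬/△-free formulas. Uniform substitution σ is handled semantically:
-- the truth of sub σ φ in ⟨v, 𝔑⟩ is the truth of φ in the model whose valuation
-- reads each letter n as σ n and whose relation is 𝔑 pulled back along sub σ;
-- that pullback is again symmetric. Axiom (s) is exactly where symmetry is needed:
-- if p ↬ q holds then ⟨p, q⟩ ∈ 𝔑, so ⟨q, p⟩ ∈ 𝔑 and q ↬ p reduces to q → p.
module Submission where

open import Defs
open import Data.Bool using (Bool; true; false; not; _∧_; _∨_)
open import Data.Product using (_,_)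
open import Relation.Binary.PropositionalEquality using (_≡_; refl; cong; cong₂; trans; sym)

evalC≡⟦⟧ : ∀ {φ} → Classical φ → ∀ v R → evalC φ v ≡ ⟦ φ ⟧ v R
evalC≡⟦⟧ (c-var n) v R = refl
evalC≡⟦⟧ (c-¬ c) v R = cong not (evalC≡⟦⟧ c v R)
evalC≡⟦⟧ (c-∨ c d) v R = cong₂ _∨_ (evalC≡⟦⟧ c v R) (evalC≡⟦⟧ d v R)
evalC≡⟦⟧ (c-∧ c d) v R = cong₂ _∧_ (evalC≡⟦⟧ c v R) (evalC≡⟦⟧ d v R)
evalC≡⟦⟧ (c-⇒ c d) v R = cong₂ _⇒ᵇ_ (evalC≡⟦⟧ c v R) (evalC≡⟦⟧ d v R)
evalC≡⟦⟧ (c-⇔ c d) v R = cong₂ _⇔ᵇ_ (evalC≡⟦⟧ c v R) (evalC≡⟦⟧ d v R)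

tautology-valid : ∀ {φ} → Tautology φ → ∀ R → R ⊨ φ
tautology-valid (c , t) R v = trans (sym (evalC≡⟦⟧ c v R)) (t v)

substValuation : Substitution → Valuation → Relation → Valuation
substValuation σ v R n = ⟦ σ n ⟧ v R

substRelation : Substitution → Relation → Relation
substRelation σ R φ ψ = R (sub σ φ) (sub σ ψ)

substRelation-symmetric : ∀ σ {R} → Symmetric R → Symmetric (substRelation σ R)
substRelation-symmetric σ sym-R φ ψ = sym-R (sub σ φ) (sub σ ψ)

⟦sub⟧ : ∀ σ φ v R → ⟦ sub σ φ ⟧ v R ≡ ⟦ φ ⟧ (substValuation σ v R) (substRelation σ R)
⟦sub⟧ σ (var n) v R = refl
⟦sub⟧ σ (¬' φ) v R = cong not (⟦sub⟧ σ φ v R)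
⟦sub⟧ σ (φ ∨' ψ) v R = cong₂ _∨_ (⟦sub⟧ σ φ v R) (⟦sub⟧ σ ψ v R)
⟦sub⟧ σ (φ ∧' ψ) v R = cong₂ _∧_ (⟦sub⟧ σ φ v R) (⟦sub⟧ σ ψ v R)
⟦sub⟧ σ (φ ⇒ ψ) v R = cong₂ _⇒ᵇ_ (⟦sub⟧ σ φ v R) (⟦sub⟧ σ ψ v R)
⟦sub⟧ σ (φ ⇔ ψ) v R = cong₂ _⇔ᵇ_ (⟦sub⟧ σ φ v R) (⟦sub⟧ σ ψ v R)
⟦sub⟧ σ (φ △ ψ) v R =
  cong (_∧ R (sub σ φ) (sub σ ψ)) (cong₂ _∧_ (⟦sub⟧ σ φ v R) (⟦sub⟧ σ ψ v R))
⟦sub⟧ σ (φ ↬ ψ) v R =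
  cong (_∧ R (sub σ φ) (sub σ ψ)) (cong₂ _⇒ᵇ_ (⟦sub⟧ σ φ v R) (⟦sub⟧ σ ψ v R))

⇒ᵇ-modusPonens : ∀ a b → a ≡ true → (a ⇒ᵇ b) ≡ true → b ≡ true
⇒ᵇ-modusPonens true b refl a⇒b = a⇒b

ax1-valid : ∀ a b r → (((a ⇒ᵇ b) ∧ r) ⇒ᵇ (a ⇒ᵇ b)) ≡ true
ax1-valid true  true  true  = refl
ax1-valid true  true  false = refl
ax1-valid true  false true  = refl
ax1-valid true  false false = refl
ax1-valid false b     true  = refl
ax1-valid false b     false = refl

ax2-valid : ∀ a b r → (((a ∧ b) ∧ r) ⇔ᵇ (((a ⇒ᵇ b) ∧ r) ∧ (a ∧ b))) ≡ true
ax2-valid true  true  true  = refl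
ax2-valid true  true  false = refl
ax2-valid true  false true  = refl
ax2-valid true  false false = refl
ax2-valid false b     true  = refl
ax2-valid false b     false = refl

axS-valid : ∀ a b r s → (r ≡ true → s ≡ true) →
            (((a ⇒ᵇ b) ∧ r) ⇒ᵇ (((b ⇒ᵇ a) ∧ s) ∨ not (b ⇒ᵇ a))) ≡ true
axS-valid a     b     false s     r⇒s = axS-false a b s
  where
  axS-false : ∀ a b s → (((a ⇒ᵇ b) ∧ false) ⇒ᵇ (((b ⇒ᵇ a) ∧ s) ∨ not (b ⇒ᵇ a))) ≡ true
  axS-false true  true  s = refl
  axS-false true  false s = refl
  axS-false false true  s = refl
  axS-false false false s = refl
axS-valid a     b     true  s     r⇒s with r⇒s refl
axS-valid true  true  true  .true r⇒s | refl = refl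
axS-valid true  false true  .true r⇒s | refl = refl
axS-valid false true  true  .true r⇒s | refl = refl
axS-valid false false true  .true r⇒s | refl = refl

FS-sound : ∀ {φ} → FS φ → ∀ R → Symmetric R → R ⊨ φ
FS-sound (taut t) R sym-R = tautology-valid t R
FS-sound a1 R sym-R v = ax1-valid (v 0) (v 1) (R p q)
FS-sound a2 R sym-R v = ax2-valid (v 0) (v 1) (R p q)
FS-sound aS R sym-R v = axS-valid (v 0) (v 1) (R p q) (R q p) (sym-R p q)
FS-sound (subst-rule σ {φ} ⊢φ) R sym-R v =
  trans (⟦sub⟧ σ φ v R)
        (FS-sound ⊢φ (substRelation σ R) (substRelation-symmetric σ sym-R) (substValuation σ v R))
FS-sound (mp {φ} {ψ} ⊢φ ⊢φ⇒ψ) R sym-R v =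
  ⇒ᵇ-modusPonens (⟦ φ ⟧ v R) (⟦ ψ ⟧ v R) (FS-sound ⊢φ R sym-R v) (FS-sound ⊢φ⇒ψ R sym-R v)

mainTheorem6 : ∀ (φ : FOR) (R : Relation) → Symmetric R → FS φ → R ⊨ φ
mainTheorem6 φ R sym-R ⊢φ = FS-sound ⊢φ R sym-R
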